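{- Let $m$ be a positive integer, $q=m+1$ and $A=\{0,1,\ldots,m\}$. If $x\in J_{A,-q}=\bigl[\frac{ -mq}{q^2-1},\frac{m}{q^2-1}\bigr]$ and $(d_i)$ is an optimal expansion of $x$ in base $-q$, then $(d_i)$ is the unique expansion of $x$ in base $-q$. (That is, in negative integer bases only the unique expansions are optimal.)
   Context: An expansion of a real number $x$ in base $-q$ is a sequence $(c_i)_{i\ge1}$ of digits $c_i\in A$ with $\sum_{i=1}^\infty c_i(-q)^{ -i}=x$; every $x\in J_{A,-q}$ has at least one such expansion. An expansion $(d_i)$ of $x$ in base $-q$ is optimal if for every expansion $(c_i)$ of $x$ in base $-q$ and every $n\ge1$, $\bigl|x-\sum_{i=1}^n d_i(-q)^{ -i}\bigr|\le\bigl|x-\sum_{i=1}^n c_i(-q)^{ -i}\bigr|$. -}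

module Defs where

open import Data.Nat as ℕ using (ℕ; zero; suc)
open import Data.Fin using (Fin; toℕ)
open import Data.Integer using (+_; -[1+_])
open import Data.Rational using (ℚ; 0ℚ; 1ℚ; _+_; _*_; _-_; ∣_∣; _≤_; _<_; _/_)
open import Data.Product using (Σ; ∃; _×_)

-- Digit sequences for base -q with q = m + 1 and digit set A = {0,…,m}.
-- A sequence c : ℕ → Fin (suc m) is 0-indexed: (c i) is the paper's digit c_{i+1}.
Digits : ℕ → Set
Digits m = ℕ → Fin (suc m)

negPow : (m : ℕ) → ℕ → ℚ
negPow m zero    = 1ℚ
negPow m (suc i) = negPow m i * (-[1+ 0 ] / suc m)

S : (m : ℕ) → Digits m → ℕ → ℚ
S m c zero    = 0ℚ
S m c (suc n) = S m c n + ((+ toℕ (c n)) / 1) * negPow m (suc n)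

-- For rational sequences a, b converging (as all sequences below do) to reals
-- α, β:  α ≤ β  iff  ∀ ε > 0, eventually a k ≤ b k + ε.
LimLe : (ℕ → ℚ) → (ℕ → ℚ) → Set
LimLe a b = (ε : ℚ) → 0ℚ < ε → ∃ λ N → (k : ℕ) → N ℕ.≤ k → a k ≤ b k + ε

-- The values Σ c_i(-q)^{-i} and Σ d_i(-q)^{-i} are equal (limits of the partial sums coincide).
SameValue : (m : ℕ) → Digits m → Digits m → Set
SameValue m c d = (ε : ℚ) → 0ℚ < ε → ∃ λ N → (k : ℕ) → N ℕ.≤ k → ∣ S m c k - S m d k ∣ ≤ ε

-- d is an optimal expansion of x := Σ d_i(-q)^{-i}: for every expansion c of x
-- and every n ≥ 1,  |x - S_n(d)| ≤ |x - S_n(c)|, where x = lim_k S_k(d).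
Optimal : (m : ℕ) → Digits m → Set
Optimal m d = (c : Digits m) → SameValue m c d → (n : ℕ) → 1 ℕ.≤ n →
  LimLe (λ k → ∣ S m d k - S m d n ∣) (λ k → ∣ S m d k - S m c n ∣)

UniqueExpansion : (m : ℕ) → Digits m → Set
UniqueExpansion m d = (c : Digits m) → SameValue m c d → (i : ℕ) → c i ≡ d i
  where open import Relation.Binary.PropositionalEquality using (_≡_)

{-# OPTIONS --safe #-}
-- If c and d are expansions of the same x, then S_n(c) − S_n(d) = g_n (−q)^(−n) for integers g_n
-- with g_0 = 0 and g_(n+1) = c_(n+1) − d_(n+1) − q g_n, while x − S_n(·) = (−q)^(−n) t with t in
-- J = [−q/(q+1), 1/(q+1)], an interval of length 1; hence |g_n| ≤ 1.  If g_n = −1 with n ≥ 1, the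
-- tails of c and d sit at opposite ends of J, which puts x closer to S_n(c) than to S_n(d) once
-- q ≥ 2, contradicting optimality of d.  If g_n = 1, then g_(n+1) ≤ m − q = −1, so g_(n+1) = −1,
-- again impossible.  Hence all g_n vanish, and so do the digit differences g_(n+1) + q g_n.
module Submission where

open import Data.Empty using (⊥)
open import Data.Fin using (Fin; toℕ)
import Data.Fin.Properties as Fin
open import Data.Integer as ℤ using (ℤ; +_; +[1+_]; -[1+_]; 0ℤ; 1ℤ; -1ℤ)
import Data.Integer.Properties as ℤ
import Data.Integer.Tactic.RingSolver as ℤ-Solver
open import Data.Nat as ℕ using (ℕ; zero; suc; s≤s; z≤n)
import Data.Nat.Coprimality as Coprimality
import Data.Nat.Properties as ℕ
open import Data.Product using (∃; _×_; _,_; proj₁; proj₂)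
open import Data.Rational
  using (ℚ; mkℚ; 0ℚ; 1ℚ; ½; _+_; _*_; _-_; -_; 1/_; _/_; ∣_∣; _≤_; _<_; *≤*; Positive; positive; nonNegative)
open import Data.Rational.Properties
open import Data.Sum using (inj₁; inj₂)
open import Level using (0ℓ)
open import Relation.Binary.PropositionalEquality
open import Relation.Nullary using (contradiction)
open import Relation.Nullary.Decidable.Core using (dec⇒maybe)
open import Tactic.RingSolver using (solve-∀)
open import Tactic.RingSolver.Core.AlmostCommutativeRing using (AlmostCommutativeRing; fromCommutativeRing)

open import Defs

ℚ-ring : AlmostCommutativeRing 0ℓ 0ℓ
ℚ-ring = fromCommutativeRing +-*-commutativeRing (λ p → dec⇒maybe (0ℚ ≟ p))

p≤q⇒0≤q-p : ∀ {p q} → p ≤ q → 0ℚ ≤ q - p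
p≤q⇒0≤q-p {p} {q} p≤q = subst (_≤ q - p) (+-inverseʳ p) (+-monoˡ-≤ (- p) p≤q)

0≤q-p⇒p≤q : ∀ {p q} → 0ℚ ≤ q - p → p ≤ q
0≤q-p⇒p≤q {p} {q} 0≤q-p = subst₂ _≤_ (+-identityˡ p) (minus-plus q p) (+-monoˡ-≤ p 0≤q-p)
  where
  minus-plus : ∀ q p → q - p + p ≡ q
  minus-plus = solve-∀ ℚ-ring

0≤1 : 0ℚ ≤ 1ℚ
0≤1 = *≤* (ℤ.+≤+ z≤n)

0≤+ : ∀ {p q} → 0ℚ ≤ p → 0ℚ ≤ q → 0ℚ ≤ p + q
0≤+ = +-mono-≤

0≤* : ∀ {p q} → 0ℚ ≤ p → 0ℚ ≤ q → 0ℚ ≤ p * q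
0≤* {p} {q} 0≤p 0≤q = subst (_≤ p * q) (*-zeroʳ p) (*-monoˡ-≤-nonNeg p {{nonNegative 0≤p}} 0≤q)

0≤*-cancelˡ : ∀ {r p} → 0ℚ < r → 0ℚ ≤ r * p → 0ℚ ≤ p
0≤*-cancelˡ {r} {p} 0<r 0≤rp = *-cancelˡ-≤-pos r {{positive 0<r}} (subst (_≤ r * p) (sym (*-zeroʳ r)) 0≤rp)

0≤∣p∣-p : ∀ p → 0ℚ ≤ ∣ p ∣ - p
0≤∣p∣-p p with ∣p∣≡p∨∣p∣≡-p p
... | inj₁ ∣p∣≡p  = subst (λ x → 0ℚ ≤ x - p) (sym ∣p∣≡p) (≤-reflexive (sym (+-inverseʳ p)))
... | inj₂ ∣p∣≡-p = subst (λ x → 0ℚ ≤ x - p) (sym ∣p∣≡-p) (0≤+ 0≤-p 0≤-p)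
  where
  0≤-p = subst (0ℚ ≤_) ∣p∣≡-p (0≤∣p∣ p)

0≤∣p∣+p : ∀ p → 0ℚ ≤ ∣ p ∣ + p
0≤∣p∣+p p = subst (0ℚ ≤_) (trans (cong (_- - p) (∣-p∣≡∣p∣ p)) (minus-neg ∣ p ∣ p)) (0≤∣p∣-p (- p))
  where
  minus-neg : ∀ x p → x - - p ≡ x + p
  minus-neg = solve-∀ ℚ-ring

∣p∣≤q⇒0≤q-p : ∀ {p q} → ∣ p ∣ ≤ q → 0ℚ ≤ q - p
∣p∣≤q⇒0≤q-p {p} {q} ∣p∣≤q = subst (0ℚ ≤_) (telescope q ∣ p ∣ p) (0≤+ (p≤q⇒0≤q-p ∣p∣≤q) (0≤∣p∣-p p))
  where
  telescope : ∀ q x p → (q - x) + (x - p) ≡ q - p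
  telescope = solve-∀ ℚ-ring

∣p∣≤q⇒0≤q+p : ∀ {p q} → ∣ p ∣ ≤ q → 0ℚ ≤ q + p
∣p∣≤q⇒0≤q+p {p} {q} ∣p∣≤q = subst (0ℚ ≤_) (telescope q ∣ p ∣ p) (0≤+ (p≤q⇒0≤q-p ∣p∣≤q) (0≤∣p∣+p p))
  where
  telescope : ∀ q x p → (q - x) + (x + p) ≡ q + p
  telescope = solve-∀ ℚ-ring

0≤q-p⇒0≤q+p⇒∣p∣≤q : ∀ {p q} → 0ℚ ≤ q - p → 0ℚ ≤ q + p → ∣ p ∣ ≤ q
0≤q-p⇒0≤q+p⇒∣p∣≤q {p} {q} 0≤q-p 0≤q+p with ∣p∣≡p∨∣p∣≡-p p
... | inj₁ ∣p∣≡p  = subst (_≤ q) (sym ∣p∣≡p) (0≤q-p⇒p≤q 0≤q-p)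
... | inj₂ ∣p∣≡-p = subst (_≤ q) (sym ∣p∣≡-p) (0≤q-p⇒p≤q (subst (0ℚ ≤_) (minus-neg q p) 0≤q+p))
  where
  minus-neg : ∀ q p → q + p ≡ q - - p
  minus-neg = solve-∀ ℚ-ring

fromℤ : ℤ → ℚ
fromℤ i = i / 1

fromℤ≡mkℚ : ∀ i → fromℤ i ≡ mkℚ i 0 (Coprimality.sym (Coprimality.1-coprimeTo ℤ.∣ i ∣))
fromℤ≡mkℚ i = fromℚᵘ-toℚᵘ (mkℚ i 0 _)

fromℤ-homo-+ : ∀ i j → fromℤ (i ℤ.+ j) ≡ fromℤ i + fromℤ j
fromℤ-homo-+ i j = begin
  fromℤ (i ℤ.+ j)               ≡⟨ cong fromℤ (sym (cong₂ ℤ._+_ (ℤ.*-identityʳ i) (ℤ.*-identityʳ j))) ⟩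
  fromℤ (i ℤ.* 1ℤ ℤ.+ j ℤ.* 1ℤ) ≡⟨ sym (cong₂ _+_ (fromℤ≡mkℚ i) (fromℤ≡mkℚ j)) ⟩
  fromℤ i + fromℤ j             ∎
  where open ≡-Reasoning

fromℤ-homo-* : ∀ i j → fromℤ (i ℤ.* j) ≡ fromℤ i * fromℤ j
fromℤ-homo-* i j = sym (cong₂ _*_ (fromℤ≡mkℚ i) (fromℤ≡mkℚ j))

fromℤ-homo‿- : ∀ i → fromℤ (ℤ.- i) ≡ - fromℤ i
fromℤ-homo‿- (+ zero)  = refl
fromℤ-homo‿- +[1+ n ]  = refl
fromℤ-homo‿- -[1+ n ]  = neg-involutive (fromℤ (+ suc n))
  where
  neg-involutive : ∀ p → p ≡ - - p
  neg-involutive = solve-∀ ℚ-ring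

fromℤ-homo-- : ∀ i j → fromℤ (i ℤ.- j) ≡ fromℤ i - fromℤ j
fromℤ-homo-- i j = trans (fromℤ-homo-+ i (ℤ.- j)) (cong (λ x → fromℤ i + x) (fromℤ-homo‿- j))

fromℤ-mono-≤ : ∀ {i j} → i ℤ.≤ j → fromℤ i ≤ fromℤ j
fromℤ-mono-≤ {i} {j} i≤j = subst₂ _≤_ (sym (fromℤ≡mkℚ i)) (sym (fromℤ≡mkℚ j))
  (*≤* (subst₂ ℤ._≤_ (sym (ℤ.*-identityʳ i)) (sym (ℤ.*-identityʳ j)) i≤j))

0≤fromℤ+ : ∀ n → 0ℚ ≤ fromℤ (+ n)
0≤fromℤ+ n = fromℤ-mono-≤ {0ℤ} {+ n} (ℤ.+≤+ z≤n)

∣fromℤ∣≤3/2⇒∣i∣≤1 : ∀ i → ∣ fromℤ i ∣ ≤ + 3 / 2 → ℤ.∣ i ∣ ℕ.≤ 1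
∣fromℤ∣≤3/2⇒∣i∣≤1 i h = ≤1 ℤ.∣ i ∣ (drop-*≤* (subst (λ x → ∣ x ∣ ≤ + 3 / 2) (fromℤ≡mkℚ i) h))
  where
  ≤1 : ∀ n → + n ℤ.* + 2 ℤ.≤ + 3 → n ℕ.≤ 1
  ≤1 0 _ = z≤n
  ≤1 1 _ = s≤s z≤n
  ≤1 (suc (suc n)) (ℤ.+≤+ (s≤s (s≤s (s≤s ()))))

∣i∣≤1⇒i≤-1⇒i≡-1 : ∀ {i} → ℤ.∣ i ∣ ℕ.≤ 1 → i ℤ.≤ -1ℤ → i ≡ -1ℤ
∣i∣≤1⇒i≤-1⇒i≡-1 { -[1+ zero ]}  _           _  = refl
∣i∣≤1⇒i≤-1⇒i≡-1 { -[1+ suc n ]} (s≤s ())    _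
∣i∣≤1⇒i≤-1⇒i≡-1 {+ n}          _           ()

∣i∣≤1⇒i≢±1⇒i≡0 : ∀ {i} → ℤ.∣ i ∣ ℕ.≤ 1 → i ≢ 1ℤ → i ≢ -1ℤ → i ≡ 0ℤ
∣i∣≤1⇒i≢±1⇒i≡0 {+ zero}        _        _    _     = refl
∣i∣≤1⇒i≢±1⇒i≡0 {+ suc zero}    _        i≢1  _     = contradiction refl i≢1
∣i∣≤1⇒i≢±1⇒i≡0 {+ suc (suc n)} (s≤s ()) _    _
∣i∣≤1⇒i≢±1⇒i≡0 { -[1+ zero ]}   _        _    i≢-1  = contradiction refl i≢-1
∣i∣≤1⇒i≢±1⇒i≡0 { -[1+ suc n ]}  (s≤s ()) _    _

-- t ∈ [−q/(q+1), 1/(q+1)] with denominators cleared; for q = m + 1 this is the paper's J_{A,−q}.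
InJ : ℚ → ℚ → Set
InJ q t = 0ℚ ≤ (q + 1ℚ) * t + q × 0ℚ ≤ 1ℚ - (q + 1ℚ) * t

InJ-0 : ∀ {q} → 0ℚ ≤ q → InJ q 0ℚ
InJ-0 {q} 0≤q = subst (0ℚ ≤_) (lower q) 0≤q , subst (0ℚ ≤_) (upper q) 0≤1
  where
  lower : ∀ q → q ≡ (q + 1ℚ) * 0ℚ + q
  lower = solve-∀ ℚ-ring
  upper : ∀ q → 1ℚ ≡ 1ℚ - (q + 1ℚ) * 0ℚ
  upper = solve-∀ ℚ-ring

InJ-step : ∀ {q a t s} → 0ℚ < q → 0ℚ ≤ a → 1ℚ + a ≤ q → q * s ≡ - (a + t) → InJ q t → InJ q s
InJ-step {q} {a} {t} {s} 0<q 0≤a 1+a≤q qs≡-[a+t] (t-lower , t-upper) =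
  0≤*-cancelˡ 0<q (subst (0ℚ ≤_) (sym lower) (0≤+ (0≤* 0≤q+1 (p≤q⇒0≤q-p 1+a≤q)) t-upper)) ,
  0≤*-cancelˡ 0<q (subst (0ℚ ≤_) (sym upper) (0≤+ (0≤* 0≤q+1 0≤a) t-lower))
  where
  0≤q+1 : 0ℚ ≤ q + 1ℚ
  0≤q+1 = 0≤+ (<⇒≤ 0<q) 0≤1
  lower : q * ((q + 1ℚ) * s + q) ≡ (q + 1ℚ) * (q - (1ℚ + a)) + (1ℚ - (q + 1ℚ) * t)
  lower = begin
    q * ((q + 1ℚ) * s + q)     ≡⟨ expand q s ⟩
    (q + 1ℚ) * (q * s) + q * q ≡⟨ cong (λ x → (q + 1ℚ) * x + q * q) qs≡-[a+t] ⟩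
    (q + 1ℚ) * - (a + t) + q * q ≡⟨ regroup q a t ⟩
    (q + 1ℚ) * (q - (1ℚ + a)) + (1ℚ - (q + 1ℚ) * t) ∎
    where
    open ≡-Reasoning
    expand : ∀ q s → q * ((q + 1ℚ) * s + q) ≡ (q + 1ℚ) * (q * s) + q * q
    expand = solve-∀ ℚ-ring
    regroup : ∀ q a t → (q + 1ℚ) * - (a + t) + q * q ≡ (q + 1ℚ) * (q - (1ℚ + a)) + (1ℚ - (q + 1ℚ) * t)
    regroup = solve-∀ ℚ-ring
  upper : q * (1ℚ - (q + 1ℚ) * s) ≡ (q + 1ℚ) * a + ((q + 1ℚ) * t + q)
  upper = begin
    q * (1ℚ - (q + 1ℚ) * s)     ≡⟨ expand q s ⟩
    q - (q + 1ℚ) * (q * s)     ≡⟨ cong (λ x → q - (q + 1ℚ) * x) qs≡-[a+t] ⟩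
    q - (q + 1ℚ) * - (a + t)   ≡⟨ regroup q a t ⟩
    (q + 1ℚ) * a + ((q + 1ℚ) * t + q) ∎
    where
    open ≡-Reasoning
    expand : ∀ q s → q * (1ℚ - (q + 1ℚ) * s) ≡ q - (q + 1ℚ) * (q * s)
    expand = solve-∀ ℚ-ring
    regroup : ∀ q a t → q - (q + 1ℚ) * - (a + t) ≡ (q + 1ℚ) * a + ((q + 1ℚ) * t + q)
    regroup = solve-∀ ℚ-ring

InJ⇒∣s-t∣≤1 : ∀ {q s t} → 0ℚ < q → InJ q s → InJ q t → ∣ s - t ∣ ≤ 1ℚ
InJ⇒∣s-t∣≤1 {q} {s} {t} 0<q (s-lower , s-upper) (t-lower , t-upper) =
  0≤q-p⇒0≤q+p⇒∣p∣≤q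
    (0≤*-cancelˡ 0<q+1 (subst (0ℚ ≤_) (sym (regroup-upper q s t)) (0≤+ s-upper t-lower)))
    (0≤*-cancelˡ 0<q+1 (subst (0ℚ ≤_) (sym (regroup-lower q s t)) (0≤+ t-upper s-lower)))
  where
  0<q+1 : 0ℚ < q + 1ℚ
  0<q+1 = +-mono-< 0<q (positive⁻¹ 1ℚ)
  regroup-upper : ∀ q s t → (q + 1ℚ) * (1ℚ - (s - t)) ≡ (1ℚ - (q + 1ℚ) * s) + ((q + 1ℚ) * t + q)
  regroup-upper = solve-∀ ℚ-ring
  regroup-lower : ∀ q s t → (q + 1ℚ) * (1ℚ + (s - t)) ≡ (1ℚ - (q + 1ℚ) * t) + ((q + 1ℚ) * s + q)
  regroup-lower = solve-∀ ℚ-ring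

0≰-1/10 : 0ℚ ≤ - (+ 1 / 10) → ⊥
0≰-1/10 (*≤* ())

-- s − t ≈ 1 pushes s and t to the ends 1/(q+1) and −q/(q+1) of J, where |t| ≈ q/(q+1) exceeds
-- |t + 1| ≈ 1/(q+1) since q ≥ 2; certificate is the nonnegative combination of the hypotheses
-- that makes this quantitative.
crossed-tails-absurd : ∀ {q s t} → + 2 / 1 ≤ q → InJ q s → InJ q t →
                       ∣ (s - t) - 1ℚ ∣ ≤ + 1 / 10 → ∣ t ∣ ≤ ∣ t + 1ℚ ∣ + + 1 / 10 → ⊥
crossed-tails-absurd {q} {s} {t} 2≤q (_ , s-upper) (t-lower , _) s≈t+1 t-closer =
  0≰-1/10 (subst (0ℚ ≤_) (certificate q s t ∣ t ∣)
    (0≤+ (0≤+ (0≤* 0≤q+1 (0≤+ (0≤+ t-closer′ (0≤∣p∣+p t)) (0≤+ s≈t+1′ s≈t+1′))) (0≤+ s-upper s-upper))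
         (0≤* 0≤7/10 0≤q-2)))
  where
  0≤q-2 : 0ℚ ≤ q - + 2 / 1
  0≤q-2 = p≤q⇒0≤q-p 2≤q
  0<q+1 : 0ℚ < q + 1ℚ
  0<q+1 = subst (0ℚ <_) (shift q) (+-mono-≤-< 0≤q-2 (positive⁻¹ (+ 3 / 1)))
    where
    shift : ∀ q → (q - + 2 / 1) + + 3 / 1 ≡ q + 1ℚ
    shift = solve-∀ ℚ-ring
  0≤q+1 : 0ℚ ≤ q + 1ℚ
  0≤q+1 = <⇒≤ 0<q+1
  0≤t+1 : 0ℚ ≤ t + 1ℚ
  0≤t+1 = 0≤*-cancelˡ 0<q+1 (subst (0ℚ ≤_) (regroup q t) (0≤+ t-lower 0≤1))
    where
    regroup : ∀ q t → ((q + 1ℚ) * t + q) + 1ℚ ≡ (q + 1ℚ) * (t + 1ℚ)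
    regroup = solve-∀ ℚ-ring
  t-closer′ : 0ℚ ≤ (t + 1ℚ + + 1 / 10) - ∣ t ∣
  t-closer′ = p≤q⇒0≤q-p (subst (λ x → ∣ t ∣ ≤ x + + 1 / 10) (0≤p⇒∣p∣≡p 0≤t+1) t-closer)
  s≈t+1′ : 0ℚ ≤ + 1 / 10 + ((s - t) - 1ℚ)
  s≈t+1′ = ∣p∣≤q⇒0≤q+p s≈t+1
  0≤7/10 : 0ℚ ≤ + 7 / 10
  0≤7/10 = *≤* (ℤ.+≤+ z≤n)
  certificate : ∀ q s t a →
    (q + 1ℚ) * ((((t + 1ℚ + + 1 / 10) - a) + (a + t)) + ((+ 1 / 10 + ((s - t) - 1ℚ)) + (+ 1 / 10 + ((s - t) - 1ℚ))))
    + ((1ℚ - (q + 1ℚ) * s) + (1ℚ - (q + 1ℚ) * s)) + + 7 / 10 * (q - + 2 / 1)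
    ≡ - (+ 1 / 10)
  certificate = solve-∀ ℚ-ring

module NegativeBase (m : ℕ) where

  q : ℚ
  q = fromℤ (+ suc m)

  -1/q : ℚ
  -1/q = -[1+ 0 ] / suc m

  private
    q′ : ℚ
    q′ = mkℚ (+ suc m) 0 (Coprimality.sym (Coprimality.1-coprimeTo (suc m)))

    -1/q≡-1/q′ : -1/q ≡ - (1/ q′)
    -1/q≡-1/q′ = cong -_ (normalize-coprime (Coprimality.1-coprimeTo (suc m)))

  q*-1/q≡-1 : q * -1/q ≡ - 1ℚ
  q*-1/q≡-1 = begin
    q * -1/q          ≡⟨ cong₂ _*_ (fromℤ≡mkℚ (+ suc m)) -1/q≡-1/q′ ⟩
    q′ * - (1/ q′)    ≡⟨ sym (neg-distribʳ-* q′ (1/ q′)) ⟩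
    - (q′ * (1/ q′))  ≡⟨ cong -_ (*-inverseʳ q′) ⟩
    - 1ℚ              ∎
    where open ≡-Reasoning

  0<q : 0ℚ < q
  0<q = subst (0ℚ <_) (sym (fromℤ≡mkℚ (+ suc m))) (positive⁻¹ q′)

  ∣negPow∣-pos : ∀ n → Positive ∣ negPow m n ∣
  ∣negPow∣-pos zero    = _
  ∣negPow∣-pos (suc n) = subst Positive (sym (∣p*q∣≡∣p∣*∣q∣ (negPow m n) -1/q))
    (pos*pos⇒pos (∣ negPow m n ∣) {{∣negPow∣-pos n}} (∣ -1/q ∣) {{∣-1/q∣-pos}})
    where
    ∣-1/q∣-pos : Positive ∣ -1/q ∣
    ∣-1/q∣-pos = subst Positive (sym (cong ∣_∣ -1/q≡-1/q′)) _

  negPow≡-q*negPow-suc : ∀ n → negPow m n ≡ - (q * negPow m (suc n))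
  negPow≡-q*negPow-suc n = begin
    negPow m n                   ≡⟨ double-neg (negPow m n) ⟩
    - (negPow m n * - 1ℚ)        ≡⟨ cong (λ x → - (negPow m n * x)) (sym q*-1/q≡-1) ⟩
    - (negPow m n * (q * -1/q))  ≡⟨ cong -_ (swap (negPow m n) q -1/q) ⟩
    - (q * negPow m (suc n))     ∎
    where
    open ≡-Reasoning
    double-neg : ∀ p → p ≡ - (p * - 1ℚ)
    double-neg = solve-∀ ℚ-ring
    swap : ∀ p q w → p * (q * w) ≡ q * (p * w)
    swap = solve-∀ ℚ-ring

  negPow-+ : ∀ i j → negPow m (i ℕ.+ j) ≡ negPow m i * negPow m j
  negPow-+ zero    j = sym (*-identityˡ (negPow m j))
  negPow-+ (suc i) j = begin
    negPow m (i ℕ.+ j) * -1/q           ≡⟨ cong (_* -1/q) (negPow-+ i j) ⟩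
    negPow m i * negPow m j * -1/q      ≡⟨ swap (negPow m i) (negPow m j) -1/q ⟩
    negPow m i * -1/q * negPow m j      ∎
    where
    open ≡-Reasoning
    swap : ∀ p r w → p * r * w ≡ p * w * r
    swap = solve-∀ ℚ-ring

  shift : ℕ → Digits m → Digits m
  shift n c i = c (n ℕ.+ i)

  S-+ : ∀ c n k → S m c (n ℕ.+ k) ≡ S m c n + negPow m n * S m (shift n c) k
  S-+ c n zero = begin
    S m c (n ℕ.+ 0)            ≡⟨ cong (S m c) (ℕ.+-identityʳ n) ⟩
    S m c n                    ≡⟨ plus-zero (S m c n) (negPow m n) ⟩
    S m c n + negPow m n * 0ℚ  ∎
    where
    open ≡-Reasoning
    plus-zero : ∀ s p → s ≡ s + p * 0ℚ
    plus-zero = solve-∀ ℚ-ring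
  S-+ c n (suc k) = begin
    S m c (n ℕ.+ suc k)                                   ≡⟨ cong (S m c) (ℕ.+-suc n k) ⟩
    S m c (n ℕ.+ k) + a * (negPow m (n ℕ.+ k) * -1/q)      ≡⟨ cong₂ (λ x y → x + a * (y * -1/q)) (S-+ c n k) (negPow-+ n k) ⟩
    (S m c n + negPow m n * T) + a * (negPow m n * negPow m k * -1/q)
                                                          ≡⟨ regroup (S m c n) (negPow m n) T a (negPow m k) -1/q ⟩
    S m c n + negPow m n * (T + a * (negPow m k * -1/q))   ∎
    where
    open ≡-Reasoning
    a = fromℤ (+ toℕ (c (n ℕ.+ k)))
    T = S m (shift n c) k
    regroup : ∀ s p t a r w → (s + p * t) + a * (p * r * w) ≡ s + p * (t + a * (r * w))
    regroup = solve-∀ ℚ-ring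

  1+digit≤q : ∀ (i : Fin (suc m)) → 1ℚ + fromℤ (+ toℕ i) ≤ q
  1+digit≤q i = subst (_≤ q) (fromℤ-homo-+ 1ℤ (+ toℕ i)) (fromℤ-mono-≤ (ℤ.+≤+ (s≤s (Fin.toℕ≤pred[n] i))))

  S∈J : ∀ c k → InJ q (S m c k)
  S∈J c zero    = InJ-0 (<⇒≤ 0<q)
  S∈J c (suc k) = InJ-step {q} {a} {T} 0<q (0≤fromℤ+ (toℕ (c 0))) (1+digit≤q (c 0)) q*S≡-[a+T] (S∈J (shift 1 c) k)
    where
    a = fromℤ (+ toℕ (c 0))
    T = S m (shift 1 c) k
    q*S≡-[a+T] : q * S m c (suc k) ≡ - (a + T)
    q*S≡-[a+T] = begin
      q * S m c (1 ℕ.+ k)                              ≡⟨ cong (q *_) (S-+ c 1 k) ⟩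
      q * ((0ℚ + a * (1ℚ * -1/q)) + 1ℚ * -1/q * T)     ≡⟨ regroup q -1/q a T ⟩
      (q * -1/q) * (a + T)                             ≡⟨ cong (_* (a + T)) q*-1/q≡-1 ⟩
      - 1ℚ * (a + T)                                   ≡⟨ neg-one (a + T) ⟩
      - (a + T)                                        ∎
      where
      open ≡-Reasoning
      regroup : ∀ q w a t → q * ((0ℚ + a * (1ℚ * w)) + 1ℚ * w * t) ≡ (q * w) * (a + t)
      regroup = solve-∀ ℚ-ring
      neg-one : ∀ p → - 1ℚ * p ≡ - p
      neg-one = solve-∀ ℚ-ring

  ∣negPow*p∣≤∣negPow∣*r⇒∣p∣≤r : ∀ n {p r} → ∣ negPow m n * p ∣ ≤ ∣ negPow m n ∣ * r → ∣ p ∣ ≤ r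
  ∣negPow*p∣≤∣negPow∣*r⇒∣p∣≤r n {p} {r} h = *-cancelˡ-≤-pos ∣ negPow m n ∣ {{∣negPow∣-pos n}}
    (subst (_≤ ∣ negPow m n ∣ * r) (∣p*q∣≡∣p∣*∣q∣ (negPow m n) p) h)

  S-S-+ : ∀ c d n k → S m c (n ℕ.+ k) - S m d (n ℕ.+ k) ≡
                      (S m c n - S m d n) + negPow m n * (S m (shift n c) k - S m (shift n d) k)
  S-S-+ c d n k = trans (cong₂ _-_ (S-+ c n k) (S-+ d n k))
    (regroup (S m c n) (S m d n) (negPow m n) (S m (shift n c) k) (S m (shift n d) k))
    where
    regroup : ∀ sc sd p tc td → (sc + p * tc) - (sd + p * td) ≡ (sc - sd) + p * (tc - td)
    regroup = solve-∀ ℚ-ring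

  sameValue⇒tails-close : ∀ {c d} → SameValue m c d → ∀ n ε → 0ℚ < ε →
    ∃ λ N → ∀ k → N ℕ.≤ k →
      ∣ (S m c n - S m d n) + negPow m n * (S m (shift n c) k - S m (shift n d) k) ∣ ≤ ε
  sameValue⇒tails-close {c} {d} same n ε 0<ε with same ε 0<ε
  ... | N , close = N , λ k N≤k →
    subst (_≤ ε) (cong ∣_∣ (S-S-+ c d n k)) (close (n ℕ.+ k) (ℕ.≤-trans N≤k (ℕ.m≤n+m k n)))

  optimal⇒tail-closer : ∀ {c d} → Optimal m d → SameValue m c d → ∀ n → 1 ℕ.≤ n → ∀ ε → 0ℚ < ε →
    ∃ λ N → ∀ k → N ℕ.≤ k →
      ∣ negPow m n * S m (shift n d) k ∣ ≤ ∣ negPow m n * S m (shift n d) k - (S m c n - S m d n) ∣ + ε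
  optimal⇒tail-closer {c} {d} optimal same n 1≤n ε 0<ε with optimal c same n 1≤n ε 0<ε
  ... | N , closer = N , λ k N≤k →
    subst₂ (λ x y → ∣ x ∣ ≤ ∣ y ∣ + ε)
      (cancel (S m d n) (negPow m n) (S m (shift n d) k))
      (regroup (S m c n) (S m d n) (negPow m n) (S m (shift n d) k))
      (subst (λ x → ∣ x - S m d n ∣ ≤ ∣ x - S m c n ∣ + ε) (S-+ d n k) (closer (n ℕ.+ k) (ℕ.≤-trans N≤k (ℕ.m≤n+m k n))))
    where
    cancel : ∀ s p t → (s + p * t) - s ≡ p * t
    cancel = solve-∀ ℚ-ring
    regroup : ∀ sc sd p t → (sd + p * t) - sc ≡ p * t - (sc - sd)
    regroup = solve-∀ ℚ-ring

  sameValue⇒∣S-S∣≤ : ∀ {c d} → SameValue m c d → ∀ n ε → 0ℚ < ε →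
                      ∣ S m c n - S m d n ∣ ≤ ∣ negPow m n ∣ * (1ℚ + ε)
  sameValue⇒∣S-S∣≤ {c} {d} same n ε 0<ε = begin
    ∣ S m c n - S m d n ∣                         ≡⟨ cong ∣_∣ (regroup (S m c n - S m d n) P (Tc - Td)) ⟩
    ∣ (S m c n - S m d n + P * (Tc - Td)) - P * (Tc - Td) ∣
                                                  ≤⟨ ∣p-q∣≤∣p∣+∣q∣ (S m c n - S m d n + P * (Tc - Td)) (P * (Tc - Td)) ⟩
    ∣ S m c n - S m d n + P * (Tc - Td) ∣ + ∣ P * (Tc - Td) ∣
                                                  ≤⟨ +-mono-≤ (proj₂ close N ℕ.≤-refl) tails ⟩
    ∣ P ∣ * ε + ∣ P ∣ * 1ℚ                        ≡⟨ factor ∣ P ∣ ε ⟩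
    ∣ P ∣ * (1ℚ + ε)                              ∎
    where
    open ≤-Reasoning
    P = negPow m n
    close = sameValue⇒tails-close same n (∣ P ∣ * ε) (positive⁻¹ _ {{pos*pos⇒pos ∣ P ∣ {{∣negPow∣-pos n}} ε {{positive 0<ε}}}})
    N = proj₁ close
    Tc = S m (shift n c) N
    Td = S m (shift n d) N
    tails : ∣ P * (Tc - Td) ∣ ≤ ∣ P ∣ * 1ℚ
    tails = subst (_≤ ∣ P ∣ * 1ℚ) (sym (∣p*q∣≡∣p∣*∣q∣ P (Tc - Td)))
      (*-monoˡ-≤-nonNeg ∣ P ∣ {{nonNegative (0≤∣p∣ P)}} (InJ⇒∣s-t∣≤1 0<q (S∈J (shift n c) N) (S∈J (shift n d) N)))
    regroup : ∀ x p t → x ≡ (x + p * t) - p * t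
    regroup = solve-∀ ℚ-ring
    factor : ∀ x e → x * e + x * 1ℚ ≡ x * (1ℚ + e)
    factor = solve-∀ ℚ-ring

  optimal⇒S-S≢-negPow : 1 ℕ.≤ m → ∀ {c d} → Optimal m d → SameValue m c d →
                         ∀ n → 1 ℕ.≤ n → S m c n - S m d n ≢ - negPow m n
  optimal⇒S-S≢-negPow 1≤m {c} {d} optimal same n 1≤n S-S≡-P =
    crossed-tails-absurd 2≤q (S∈J (shift n c) L) (S∈J (shift n d) L) values-close d-closer
    where
    P = negPow m n
    η = + 1 / 10
    ε = ∣ P ∣ * η
    0<ε : 0ℚ < ε
    0<ε = positive⁻¹ _ {{pos*pos⇒pos ∣ P ∣ {{∣negPow∣-pos n}} η}}
    closer = optimal⇒tail-closer optimal same n 1≤n ε 0<ε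
    close = sameValue⇒tails-close same n ε 0<ε
    L = proj₁ closer ℕ.+ proj₁ close
    Tc = S m (shift n c) L
    Td = S m (shift n d) L
    2≤q : + 2 / 1 ≤ q
    2≤q = fromℤ-mono-≤ (ℤ.+≤+ (s≤s 1≤m))
    d-closer : ∣ Td ∣ ≤ ∣ Td + 1ℚ ∣ + η
    d-closer = ∣negPow*p∣≤∣negPow∣*r⇒∣p∣≤r n (subst (∣ P * Td ∣ ≤_) rhs (proj₂ closer L (ℕ.m≤m+n _ _)))
      where
      rhs : ∣ P * Td - (S m c n - S m d n) ∣ + ε ≡ ∣ P ∣ * (∣ Td + 1ℚ ∣ + η)
      rhs = begin
        ∣ P * Td - (S m c n - S m d n) ∣ + ε     ≡⟨ cong (λ x → ∣ P * Td - x ∣ + ε) S-S≡-P ⟩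
        ∣ P * Td - - P ∣ + ε                     ≡⟨ cong (λ x → ∣ x ∣ + ε) (factor P Td) ⟩
        ∣ P * (Td + 1ℚ) ∣ + ε                    ≡⟨ cong (_+ ε) (∣p*q∣≡∣p∣*∣q∣ P (Td + 1ℚ)) ⟩
        ∣ P ∣ * ∣ Td + 1ℚ ∣ + ∣ P ∣ * η          ≡⟨ sym (*-distribˡ-+ ∣ P ∣ ∣ Td + 1ℚ ∣ η) ⟩
        ∣ P ∣ * (∣ Td + 1ℚ ∣ + η)                ∎
        where
        open ≡-Reasoning
        factor : ∀ p t → p * t - - p ≡ p * (t + 1ℚ)
        factor = solve-∀ ℚ-ring
    values-close : ∣ (Tc - Td) - 1ℚ ∣ ≤ η
    values-close = ∣negPow*p∣≤∣negPow∣*r⇒∣p∣≤r n (subst (_≤ ε) (cong ∣_∣ lhs) (proj₂ close L (ℕ.m≤n+m _ _)))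
      where
      lhs : (S m c n - S m d n) + P * (Tc - Td) ≡ P * ((Tc - Td) - 1ℚ)
      lhs = trans (cong (_+ P * (Tc - Td)) S-S≡-P) (factor P (Tc - Td))
        where
        factor : ∀ p t → - p + p * t ≡ p * (t - 1ℚ)
        factor = solve-∀ ℚ-ring

  module Gap (c d : Digits m) where

    gap : ℕ → ℤ
    gap zero    = 0ℤ
    gap (suc n) = (+ toℕ (c n) ℤ.- + toℕ (d n)) ℤ.- + suc m ℤ.* gap n

    S-S≡gap*negPow : ∀ n → S m c n - S m d n ≡ fromℤ (gap n) * negPow m n
    S-S≡gap*negPow zero    = refl
    S-S≡gap*negPow (suc n) = begin
      S m c (suc n) - S m d (suc n)              ≡⟨ regroup (S m c n) (S m d n) a b P′ ⟩
      (S m c n - S m d n) + (a - b) * P′         ≡⟨ cong (_+ (a - b) * P′) (S-S≡gap*negPow n) ⟩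
      g * negPow m n + (a - b) * P′              ≡⟨ cong (λ x → g * x + (a - b) * P′) (negPow≡-q*negPow-suc n) ⟩
      g * - (q * P′) + (a - b) * P′              ≡⟨ factor g q a b P′ ⟩
      ((a - b) - q * g) * P′                     ≡⟨ cong (_* P′) (sym fromℤ-gap) ⟩
      fromℤ (gap (suc n)) * P′                   ∎
      where
      open ≡-Reasoning
      a = fromℤ (+ toℕ (c n))
      b = fromℤ (+ toℕ (d n))
      g = fromℤ (gap n)
      P′ = negPow m (suc n)
      fromℤ-gap : fromℤ (gap (suc n)) ≡ (a - b) - q * g
      fromℤ-gap = trans (fromℤ-homo-- (+ toℕ (c n) ℤ.- + toℕ (d n)) (+ suc m ℤ.* gap n))
        (cong₂ _-_ (fromℤ-homo-- (+ toℕ (c n)) (+ toℕ (d n))) (fromℤ-homo-* (+ suc m) (gap n)))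
      regroup : ∀ sc sd a b p → (sc + a * p) - (sd + b * p) ≡ (sc - sd) + (a - b) * p
      regroup = solve-∀ ℚ-ring
      factor : ∀ g q a b p → g * - (q * p) + (a - b) * p ≡ ((a - b) - q * g) * p
      factor = solve-∀ ℚ-ring

    gap≡1⇒gap-suc≤-1 : ∀ n → gap n ≡ 1ℤ → gap (suc n) ℤ.≤ -1ℤ
    gap≡1⇒gap-suc≤-1 n gap≡1 = begin
      (a ℤ.- b) ℤ.- + suc m ℤ.* gap n   ≡⟨ cong (λ g → (a ℤ.- b) ℤ.- + suc m ℤ.* g) gap≡1 ⟩
      (a ℤ.- b) ℤ.- + suc m ℤ.* 1ℤ      ≤⟨ ℤ.+-monoˡ-≤ (ℤ.- (+ suc m ℤ.* 1ℤ)) (ℤ.i-j≤i a b) ⟩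
      a ℤ.- + suc m ℤ.* 1ℤ              ≤⟨ ℤ.+-monoˡ-≤ (ℤ.- (+ suc m ℤ.* 1ℤ)) (ℤ.+≤+ (Fin.toℕ≤pred[n] (c n))) ⟩
      + m ℤ.- + suc m ℤ.* 1ℤ            ≡⟨ last-digit (+ m) ⟩
      -1ℤ                               ∎
      where
      open ℤ.≤-Reasoning
      a = + toℕ (c n)
      b = + toℕ (d n)
      last-digit : ∀ i → i ℤ.- (1ℤ ℤ.+ i) ℤ.* 1ℤ ≡ -1ℤ
      last-digit = ℤ-Solver.solve-∀

    ∣gap∣≤1 : SameValue m c d → ∀ n → ℤ.∣ gap n ∣ ℕ.≤ 1
    ∣gap∣≤1 same n = ∣fromℤ∣≤3/2⇒∣i∣≤1 (gap n) (∣negPow*p∣≤∣negPow∣*r⇒∣p∣≤r n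
      (subst (_≤ ∣ negPow m n ∣ * (1ℚ + ½)) (cong ∣_∣ (trans (S-S≡gap*negPow n) (*-comm (fromℤ (gap n)) (negPow m n))))
             (sameValue⇒∣S-S∣≤ same n ½ (positive⁻¹ ½))))

    gap≡0 : 1 ℕ.≤ m → SameValue m c d → Optimal m d → ∀ n → gap n ≡ 0ℤ
    gap≡0 1≤m same optimal n = ∣i∣≤1⇒i≢±1⇒i≡0 (∣gap∣≤1 same n) (gap≢1 n) (gap≢-1 n)
      where
      gap≢-1 : ∀ n → gap n ≢ -1ℤ
      gap≢-1 zero    ()
      gap≢-1 (suc n) gap≡-1 = optimal⇒S-S≢-negPow 1≤m optimal same (suc n) (s≤s z≤n)
        (trans (S-S≡gap*negPow (suc n)) (trans (cong (λ i → fromℤ i * negPow m (suc n)) gap≡-1) (neg-one _)))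
        where
        neg-one : ∀ p → - 1ℚ * p ≡ - p
        neg-one = solve-∀ ℚ-ring
      gap≢1 : ∀ n → gap n ≢ 1ℤ
      gap≢1 n gap≡1 = gap≢-1 (suc n) (∣i∣≤1⇒i≤-1⇒i≡-1 (∣gap∣≤1 same (suc n)) (gap≡1⇒gap-suc≤-1 n gap≡1))

    gap≡0⇒digits≡ : ∀ n → gap n ≡ 0ℤ → gap (suc n) ≡ 0ℤ → c n ≡ d n
    gap≡0⇒digits≡ n gap≡0 gap-suc≡0 = Fin.toℕ-injective (ℤ.+-injective (ℤ.i-j≡0⇒i≡j _ _ (begin
      + toℕ (c n) ℤ.- + toℕ (d n)                          ≡⟨ sym (minus-zero _ (+ suc m)) ⟩
      (+ toℕ (c n) ℤ.- + toℕ (d n)) ℤ.- + suc m ℤ.* 0ℤ     ≡⟨ cong (λ g → (+ toℕ (c n) ℤ.- + toℕ (d n)) ℤ.- + suc m ℤ.* g) (sym gap≡0) ⟩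
      gap (suc n)                                          ≡⟨ gap-suc≡0 ⟩
      0ℤ                                                   ∎)))
      where
      open ≡-Reasoning
      minus-zero : ∀ i j → i ℤ.- j ℤ.* 0ℤ ≡ i
      minus-zero = ℤ-Solver.solve-∀

proposition4 : (m : ℕ) → 1 ℕ.≤ m → (d : Digits m) → Optimal m d → UniqueExpansion m d
proposition4 m 1≤m d optimal c same i =
  gap≡0⇒digits≡ i (gap≡0 1≤m same optimal i) (gap≡0 1≤m same optimal (suc i))
  where
  open NegativeBase m
  open Gap c d
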